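{- Let $a_1,\dots,a_d\in\mathbb Z$ with $\sum_{i=1}^d a_i$ even. For $j\in\{1,2,3,4\}$ let $s_{j,4}=\sum_{1\le i\le d,\ i\equiv j\pmod 4}a_i$, and put $A=s_{1,4}-s_{3,4}$, $B=s_{2,4}-s_{4,4}+1$, $Q=2A^2+2B^2$. Let $(x_n)_{n\ge1}$ be a real sequence satisfying $x_n=a_1x_{n-1}+\dots+a_dx_{n-d}$ for all $n>d$, and suppose that for $i=1,\dots,d$, $$x_i=\begin{cases}\frac{A^2-A+B^2-B}{Q}, & i\equiv1\pmod4,\\ \frac{A^2-A+B^2+B}{Q}, & i\equiv2\pmod4,\\ \frac{A^2+A+B^2+B}{Q}, & i\equiv3\pmod4,\\ \frac{A^2+A+B^2-B}{Q}, & i\equiv0\pmod4.\end{cases}$$ Then $(x_n)$ is periodic modulo $1$ with period of length $4$, i.e. $\{x_{n+4}\}=\{x_n\}$ for all $n\ge1$.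
   Context: $\{x\}$ denotes the fractional part of $x$. A sequence $(x_n)$ is periodic modulo 1 with period length $t$ if $\{x_n\}=\{x_{n+t}\}$ for all $n\in\mathbb N$ (the period need not be minimal).
   Formalization: The sequence $(x_n)$ takes rational values rather than real ones. -}

module Defs where

open import Data.Nat as ℕ using (ℕ; zero; suc; _∸_)
open import Data.Integer as ℤ using (ℤ)
open import Data.Rational as ℚ using (ℚ; 0ℚ; _÷_; floor; _-_; _+_; _*_)
open import Relation.Binary.PropositionalEquality using (_≡_)
open import Relation.Nullary using (yes; no)

frac : ℚ → ℚ
frac p = p - (floor p ℚ./ 1)

ι : ℤ → ℚ
ι z = z ℚ./ 1

-- division of integers as a rational number (total: value 0 when divisor is 0;
-- under the hypotheses of the lemma the divisor Q is never 0)
_÷ℤ_ : ℤ → ℤ → ℚ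
m ÷ℤ n with ι n ℚ.≟ 0ℚ
... | yes _ = 0ℚ
... | no n≢0 = _÷_ (ι m) (ι n) {{ℚ.≢-nonZero n≢0}}

Σ₁ : ℕ → (ℕ → ℚ) → ℚ
Σ₁ zero f = 0ℚ
Σ₁ (suc k) f = Σ₁ k f + f (suc k)

Σ₁ℤ : ℕ → (ℕ → ℤ) → ℤ
Σ₁ℤ zero f = ℤ.0ℤ
Σ₁ℤ (suc k) f = Σ₁ℤ k f ℤ.+ f (suc k)

-- s_{j,4} = Σ_{1 ≤ i ≤ d, i ≡ j (mod 4)} a_i   (j ∈ {0,1,2,3}, j = 0 standing for 4)
s4 : ℕ → (ℕ → ℤ) → ℕ → ℤ
s4 d a j = Σ₁ℤ d (λ i → sel (i ℕ.% 4 ℕ.≟ j) (a i))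
  where
  open import Relation.Nullary using (Dec)
  sel : ∀ {P : Set} → Dec P → ℤ → ℤ
  sel (yes _) z = z
  sel (no _) _ = ℤ.0ℤ

Aof : ℕ → (ℕ → ℤ) → ℤ
Aof d a = s4 d a 1 ℤ.- s4 d a 3

Bof : ℕ → (ℕ → ℤ) → ℤ
Bof d a = (s4 d a 2 ℤ.- s4 d a 0) ℤ.+ ℤ.1ℤ

Qof : ℕ → (ℕ → ℤ) → ℤ
Qof d a = (ℤ.+ 2) ℤ.* (Aof d a ℤ.* Aof d a) ℤ.+ (ℤ.+ 2) ℤ.* (Bof d a ℤ.* Bof d a)

initVal : ℕ → (ℕ → ℤ) → ℕ → ℚ
initVal d a i = num (i ℕ.% 4) ÷ℤ Qof d a
  where
  A = Aof d a
  B = Bof d a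
  A² = A ℤ.* A
  B² = B ℤ.* B
  num : ℕ → ℤ
  num 1 = ((A² ℤ.- A) ℤ.+ B²) ℤ.- B
  num 2 = ((A² ℤ.- A) ℤ.+ B²) ℤ.+ B
  num 3 = ((A² ℤ.+ A) ℤ.+ B²) ℤ.+ B
  num _ = ((A² ℤ.+ A) ℤ.+ B²) ℤ.- B

module Submission where

-- Write N r (r = 0,1,2,3) for the four numerators of the prescribed initial
-- values, Q for their common denominator and y n = N (n mod 4) / Q.  We show
-- that x n − y n is an integer for every n ≥ 1; as y is 4-periodic and the
-- fractional part is invariant under integer shifts, the theorem follows.
--
-- For n ≤ d it holds with
-- difference 0.  For n > d the recurrence gives, modulo integers,
-- x n ≡ Σᵢ aᵢ y (n − i) = (Σᵢ aᵢ N ((n − i) mod 4)) / Q.  Grouping the indices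
-- by their residue mod 4 turns this numerator into Σₖ sₖ N ((n − k) mod 4), and
-- a polynomial identity, valid because Σₖ sₖ = Σᵢ aᵢ is even, shows that it
-- is N (n mod 4) plus a multiple of Q.

open import Defs
open import Data.Nat using (ℕ; _≤_; _<_; _+_; _∸_)
open import Data.Integer using (ℤ; +_)
open import Data.Integer.Divisibility using (_∣_)
open import Data.Rational using (ℚ; _*_)
open import Relation.Binary.PropositionalEquality using (_≡_)

open import Data.Nat as ℕ using (zero; suc; s≤s; z≤n; _%_)
import Data.Nat.Properties as ℕP
import Data.Nat.DivMod as ℕD
import Data.Nat.GCD as ℕG
open import Data.Nat.Induction using (<-rec)
open import Data.Integer as ℤ using (0ℤ; 1ℤ)
import Data.Integer.Properties as ℤP
import Data.Integer.DivMod as ℤD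
import Data.Integer.Divisibility.Signed as ℤS
open import Data.Integer.Tactic.RingSolver using (solve-∀) renaming (solve to solveℤ)
open import Data.List using (List; []; _∷_)
open import Data.Rational as ℚ using (0ℚ; floor; ↥_; ↧_; mkℚ; 1/_) renaming (_+_ to _+ℚ_)
import Data.Rational.Properties as ℚP
open import Data.Rational.Unnormalised as ℚᵘ using (mkℚᵘ)
import Data.Rational.Unnormalised.Properties as ℚᵘP
open import Data.Rational.Solver using (module +-*-Solver)
open import Data.Product using (Σ; _×_; _,_; proj₁; proj₂)
open import Relation.Nullary using (yes; no)
import Relation.Binary.Reasoning.Base.Single
open import Relation.Binary.PropositionalEquality
  using (refl; sym; trans; cong; cong₂; subst; subst₂; module ≡-Reasoning)

↥ι : ∀ z → ↥ ι z ≡ z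
↥ι z = trans (sym (ℤP.*-identityʳ _))
  (subst (λ g → ↥ ι z ℤ.* + g ≡ z) (ℕG.gcd-zeroʳ ℤ.∣ z ∣) (ℚP.↥-/ z 1))

↧ι : ∀ z → ↧ ι z ≡ + 1
↧ι z = trans (sym (ℤP.*-identityʳ _))
  (subst (λ g → ↧ ι z ℤ.* + g ≡ + 1) (ℕG.gcd-zeroʳ ℤ.∣ z ∣) (ℚP.↧-/ z 1))

-- ι is the normalisation of the unnormalised fraction z/1, so it is a ring
-- homomorphism because normalisation is.
ι-toℚᵘ : ∀ z → ℚ.toℚᵘ (ι z) ℚᵘ.≃ mkℚᵘ z 0
ι-toℚᵘ z = ℚP.toℚᵘ-fromℚᵘ (mkℚᵘ z 0)

ι-+ : ∀ a b → ι (a ℤ.+ b) ≡ ι a +ℚ ι b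
ι-+ a b = ℚP.toℚᵘ-injective (begin
    ℚ.toℚᵘ (ι (a ℤ.+ b))            ≈⟨ ι-toℚᵘ (a ℤ.+ b) ⟩
    mkℚᵘ (a ℤ.+ b) 0                ≈⟨ ℚᵘ.*≡* (sum-over-one a b) ⟩
    mkℚᵘ a 0 ℚᵘ.+ mkℚᵘ b 0          ≈⟨ ℚᵘP.+-cong (ℚᵘP.≃-sym (ι-toℚᵘ a)) (ℚᵘP.≃-sym (ι-toℚᵘ b)) ⟩
    ℚ.toℚᵘ (ι a) ℚᵘ.+ ℚ.toℚᵘ (ι b)  ≈⟨ ℚᵘP.≃-sym (ℚP.toℚᵘ-homo-+ (ι a) (ι b)) ⟩
    ℚ.toℚᵘ (ι a +ℚ ι b)             ∎)
  where
  open ℚᵘP.≃-Reasoning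
  sum-over-one : ∀ a b → (a ℤ.+ b) ℤ.* + 1 ≡ (a ℤ.* + 1 ℤ.+ b ℤ.* + 1) ℤ.* + 1
  sum-over-one = solve-∀

ι-* : ∀ a b → ι (a ℤ.* b) ≡ ι a * ι b
ι-* a b = ℚP.toℚᵘ-injective (begin
    ℚ.toℚᵘ (ι (a ℤ.* b))            ≈⟨ ι-toℚᵘ (a ℤ.* b) ⟩
    mkℚᵘ a 0 ℚᵘ.* mkℚᵘ b 0          ≈⟨ ℚᵘP.*-cong (ℚᵘP.≃-sym (ι-toℚᵘ a)) (ℚᵘP.≃-sym (ι-toℚᵘ b)) ⟩
    ℚ.toℚᵘ (ι a) ℚᵘ.* ℚ.toℚᵘ (ι b)  ≈⟨ ℚᵘP.≃-sym (ℚP.toℚᵘ-homo-* (ι a) (ι b)) ⟩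
    ℚ.toℚᵘ (ι a * ι b)              ∎)
  where open ℚᵘP.≃-Reasoning

ι≤ : ∀ z p → z ℤ.* ↧ p ℤ.≤ ↥ p → ι z ℚ.≤ p
ι≤ z p le = ℚ.*≤* (subst₂ ℤ._≤_
  (cong (ℤ._* ↧ p) (sym (↥ι z)))
  (trans (sym (ℤP.*-identityʳ (↥ p))) (cong (↥ p ℤ.*_) (sym (↧ι z)))) le)

<ι : ∀ z p → ↥ p ℤ.< z ℤ.* ↧ p → p ℚ.< ι z
<ι z p lt = ℚ.*<* (subst₂ ℤ._<_
  (trans (sym (ℤP.*-identityʳ (↥ p))) (cong (↥ p ℤ.*_) (sym (↧ι z))))
  (cong (ℤ._* ↧ p) (sym (↥ι z))) lt)

ι-cancel-< : ∀ z w → ι z ℚ.< ι w → z ℤ.< w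
ι-cancel-< z w (ℚ.*<* lt) = subst₂ ℤ._<_
  (trans (cong₂ ℤ._*_ (↥ι z) (↧ι w)) (ℤP.*-identityʳ z))
  (trans (cong₂ ℤ._*_ (↥ι w) (↧ι z)) (ℤP.*-identityʳ w)) lt

floor-lower : ∀ p → ι (floor p) ℚ.≤ p
floor-lower p@(mkℚ n _ _) = ι≤ (floor p) p (ℤD.[n/d]*d≤n n (↧ p))

floor-upper : ∀ p → p ℚ.< ι (ℤ.suc (floor p))
floor-upper p@(mkℚ n d-1 _) = <ι (ℤ.suc (floor p)) p
  (subst (λ f → n ℤ.< ℤ.suc f ℤ.* ↧ p) (sym (ℤD.div-pos-is-/ℕ n (suc d-1)))
         (ℤD.n<s[n/ℕd]*d n (suc d-1)))

floor-unique : ∀ z p → ι z ℚ.≤ p → p ℚ.< ι (ℤ.suc z) → floor p ≡ z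
floor-unique z p z≤p p<z+1 = ℤP.≤-antisym
  (below-suc (floor p) z (ℚP.≤-<-trans (floor-lower p) p<z+1))
  (below-suc z (floor p) (ℚP.≤-<-trans z≤p (floor-upper p)))
  where
  below-suc : ∀ u v → ι u ℚ.< ι (ℤ.suc v) → u ℤ.≤ v
  below-suc u v lt = subst (u ℤ.≤_) (ℤP.pred-suc v) (ℤP.i<j⇒i≤pred[j] (ι-cancel-< u (ℤ.suc v) lt))

floor-+ι : ∀ p k → floor (p +ℚ ι k) ≡ floor p ℤ.+ k
floor-+ι p k = floor-unique (floor p ℤ.+ k) (p +ℚ ι k)
  (subst (ℚ._≤ p +ℚ ι k) (sym (ι-+ (floor p) k)) (ℚP.+-monoˡ-≤ (ι k) (floor-lower p)))
  (subst (p +ℚ ι k ℚ.<_) (trans (sym (ι-+ (ℤ.suc (floor p)) k)) (cong ι (ℤP.+-assoc (+ 1) (floor p) k)))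
         (ℚP.+-monoˡ-< (ι k) (floor-upper p)))

frac-+ι : ∀ p k → frac (p +ℚ ι k) ≡ frac p
frac-+ι p k = begin
    (p +ℚ ι k) ℚ.- ι (floor (p +ℚ ι k))   ≡⟨ cong (λ z → (p +ℚ ι k) ℚ.- ι z) (floor-+ι p k) ⟩
    (p +ℚ ι k) ℚ.- ι (floor p ℤ.+ k)      ≡⟨ cong (λ z → (p +ℚ ι k) ℚ.- z) (ι-+ (floor p) k) ⟩
    (p +ℚ ι k) ℚ.- (ι (floor p) +ℚ ι k)   ≡⟨ solve 3 (λ p k f → (p :+ k) :- (f :+ k) := p :- f) refl p (ι k) (ι (floor p)) ⟩
    p ℚ.- ι (floor p)                     ∎
  where
  open ≡-Reasoning
  open +-*-Solver

record _≡₁_ (p q : ℚ) : Set where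
  constructor by
  field
    offset : ℤ
    shift  : p ≡ q +ℚ ι offset

infix 4 _≡₁_

≡₁-frac : ∀ {p q} → p ≡₁ q → frac p ≡ frac q
≡₁-frac {p} {q} (by k p≡q+k) = trans (cong frac p≡q+k) (frac-+ι q k)

≡-to-≡₁ : ∀ {p q} → p ≡ q → p ≡₁ q
≡-to-≡₁ {p} {q} p≡q = by 0ℤ (trans p≡q (sym (ℚP.+-identityʳ q)))

≡₁-refl : ∀ {p} → p ≡₁ p
≡₁-refl = ≡-to-≡₁ refl

≡₁-trans : ∀ {p q r} → p ≡₁ q → q ≡₁ r → p ≡₁ r
≡₁-trans {p} {q} {r} (by k p≡q+k) (by l q≡r+l) = by (l ℤ.+ k) (begin
    p                       ≡⟨ p≡q+k ⟩
    q +ℚ ι k                ≡⟨ cong (_+ℚ ι k) q≡r+l ⟩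
    (r +ℚ ι l) +ℚ ι k       ≡⟨ ℚP.+-assoc r (ι l) (ι k) ⟩
    r +ℚ (ι l +ℚ ι k)       ≡⟨ cong (r +ℚ_) (sym (ι-+ l k)) ⟩
    r +ℚ ι (l ℤ.+ k)        ∎)
  where open ≡-Reasoning

module ≡₁-Reasoning = Relation.Binary.Reasoning.Base.Single _≡₁_ ≡₁-refl ≡₁-trans

≡₁-+ : ∀ {p q p′ q′} → p ≡₁ q → p′ ≡₁ q′ → p +ℚ p′ ≡₁ q +ℚ q′
≡₁-+ {p} {q} {p′} {q′} (by k p≡q+k) (by k′ p′≡q′+k′) = by (k ℤ.+ k′) (begin
    p +ℚ p′                       ≡⟨ cong₂ _+ℚ_ p≡q+k p′≡q′+k′ ⟩
    (q +ℚ ι k) +ℚ (q′ +ℚ ι k′)    ≡⟨ solve 4 (λ q k q′ k′ → (q :+ k) :+ (q′ :+ k′) := (q :+ q′) :+ (k :+ k′)) refl q (ι k) q′ (ι k′) ⟩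
    (q +ℚ q′) +ℚ (ι k +ℚ ι k′)    ≡⟨ cong ((q +ℚ q′) +ℚ_) (sym (ι-+ k k′)) ⟩
    (q +ℚ q′) +ℚ ι (k ℤ.+ k′)     ∎)
  where
  open ≡-Reasoning
  open +-*-Solver

≡₁-scale : ∀ a {p q} → p ≡₁ q → ι a * p ≡₁ ι a * q
≡₁-scale a {p} {q} (by k p≡q+k) = by (a ℤ.* k) (begin
    ι a * p                   ≡⟨ cong (ι a *_) p≡q+k ⟩
    ι a * (q +ℚ ι k)          ≡⟨ ℚP.*-distribˡ-+ (ι a) q (ι k) ⟩
    ι a * q +ℚ ι a * ι k      ≡⟨ cong (ι a * q +ℚ_) (sym (ι-* a k)) ⟩
    ι a * q +ℚ ι (a ℤ.* k)    ∎)
  where open ≡-Reasoning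

≡₁-Σ₁ : ∀ j {f g : ℕ → ℚ} → (∀ i → 1 ≤ i → i ≤ j → f i ≡₁ g i) → Σ₁ j f ≡₁ Σ₁ j g
≡₁-Σ₁ zero    _     = ≡₁-refl
≡₁-Σ₁ (suc j) f≡₁g =
  ≡₁-+ (≡₁-Σ₁ j (λ i 1≤i i≤j → f≡₁g i 1≤i (ℕP.m≤n⇒m≤1+n i≤j))) (f≡₁g (suc j) (s≤s z≤n) ℕP.≤-refl)

Σ₁-ι-scale : ∀ j (f : ℕ → ℤ) c → Σ₁ j (λ i → ι (f i) * c) ≡ ι (Σ₁ℤ j f) * c
Σ₁-ι-scale zero    f c = sym (ℚP.*-zeroˡ c)
Σ₁-ι-scale (suc j) f c = begin
    Σ₁ j (λ i → ι (f i) * c) +ℚ ι (f (suc j)) * c  ≡⟨ cong (_+ℚ ι (f (suc j)) * c) (Σ₁-ι-scale j f c) ⟩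
    ι (Σ₁ℤ j f) * c +ℚ ι (f (suc j)) * c           ≡⟨ sym (ℚP.*-distribʳ-+ c (ι (Σ₁ℤ j f)) (ι (f (suc j)))) ⟩
    (ι (Σ₁ℤ j f) +ℚ ι (f (suc j))) * c             ≡⟨ cong (_* c) (sym (ι-+ (Σ₁ℤ j f) (f (suc j)))) ⟩
    ι (Σ₁ℤ j f ℤ.+ f (suc j)) * c                  ∎
  where open ≡-Reasoning

-- Dividing by a fixed integer q is multiplying by a fixed rational c (namely
-- 1/q, or 0 when q = 0), and adding a multiple of q to the numerator changes
-- the quotient by an integer.
÷ℤ-as-scaling : ∀ q → Σ ℚ λ c →
  (∀ m → m ÷ℤ q ≡ ι m * c) × (∀ m t → ι (m ℤ.+ q ℤ.* t) * c ≡₁ ι m * c)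
÷ℤ-as-scaling q with ι q ℚ.≟ 0ℚ
... | yes _    = 0ℚ , (λ m → sym (ℚP.*-zeroʳ (ι m)))
                    , (λ m t → ≡-to-≡₁ (trans (ℚP.*-zeroʳ (ι (m ℤ.+ q ℤ.* t))) (sym (ℚP.*-zeroʳ (ι m)))))
... | no q≢0 = c , (λ m → refl) , add-multiple
  where
  instance
    q-nonZero : ℚ.NonZero (ι q)
    q-nonZero = ℚ.≢-nonZero q≢0
  c : ℚ
  c = 1/ ι q
  add-multiple : ∀ m t → ι (m ℤ.+ q ℤ.* t) * c ≡₁ ι m * c
  add-multiple m t = by t (begin
      ι (m ℤ.+ q ℤ.* t) * c            ≡⟨ cong (_* c) (trans (ι-+ m (q ℤ.* t)) (cong (ι m +ℚ_) (ι-* q t))) ⟩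
      (ι m +ℚ ι q * ι t) * c           ≡⟨ ℚP.*-distribʳ-+ c (ι m) (ι q * ι t) ⟩
      ι m * c +ℚ (ι q * ι t) * c       ≡⟨ cong (ι m * c +ℚ_) (solve 3 (λ q t c → (q :* t) :* c := t :* (q :* c)) refl (ι q) (ι t) c) ⟩
      ι m * c +ℚ ι t * (ι q * c)       ≡⟨ cong (λ u → ι m * c +ℚ ι t * u) (ℚP.*-inverseʳ (ι q)) ⟩
      ι m * c +ℚ ι t * ℚ.1ℚ            ≡⟨ cong (ι m * c +ℚ_) (ℚP.*-identityʳ (ι t)) ⟩
      ι m * c +ℚ ι t                   ∎)
    where
    open ≡-Reasoning
    open +-*-Solver

-- Subtracting i is adding 3·i modulo 4, so the residue of n − i only
-- depends on the residues of n and i.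
residue-∸ : ∀ {n i} → i ≤ n → (n ∸ i) % 4 ≡ (n % 4 + 3 ℕ.* (i % 4)) % 4
residue-∸ {n} {i} i≤n = begin
    (n ∸ i) % 4                            ≡⟨ sym (ℕD.[m+kn]%n≡m%n (n ∸ i) i 4) ⟩
    (n ∸ i + i ℕ.* 4) % 4                  ≡⟨ cong (_% 4) shift-by-4i ⟩
    (n + 3 ℕ.* i) % 4                      ≡⟨ ℕD.%-distribˡ-+ n (3 ℕ.* i) 4 ⟩
    (n % 4 + (3 ℕ.* i) % 4) % 4            ≡⟨ cong (λ k → (n % 4 + k) % 4) (ℕD.%-distribˡ-* 3 i 4) ⟩
    (n % 4 + (3 ℕ.* (i % 4)) % 4) % 4      ≡⟨ cong (λ m → (m + (3 ℕ.* (i % 4)) % 4) % 4) (sym (ℕD.m%n%n≡m%n n 4)) ⟩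
    (n % 4 % 4 + (3 ℕ.* (i % 4)) % 4) % 4  ≡⟨ sym (ℕD.%-distribˡ-+ (n % 4) (3 ℕ.* (i % 4)) 4) ⟩
    (n % 4 + 3 ℕ.* (i % 4)) % 4            ∎
  where
  open ≡-Reasoning
  shift-by-4i : n ∸ i + i ℕ.* 4 ≡ n + 3 ℕ.* i
  shift-by-4i = begin
    n ∸ i + i ℕ.* 4        ≡⟨ cong (λ k → n ∸ i + k) (ℕP.*-comm i 4) ⟩
    n ∸ i + (i + 3 ℕ.* i)  ≡⟨ sym (ℕP.+-assoc (n ∸ i) i (3 ℕ.* i)) ⟩
    n ∸ i + i + 3 ℕ.* i    ≡⟨ cong (_+ 3 ℕ.* i) (ℕP.m∸n+n≡m i≤n) ⟩
    n + 3 ℕ.* i            ∎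

Σ₄ : (ℕ → ℤ) → (ℕ → ℤ) → ℤ
Σ₄ S f = S 0 ℤ.* f 0 ℤ.+ S 1 ℤ.* f 1 ℤ.+ S 2 ℤ.* f 2 ℤ.+ S 3 ℤ.* f 3

Σ₄-+ : ∀ S T f → Σ₄ (λ r → S r ℤ.+ T r) f ≡ Σ₄ S f ℤ.+ Σ₄ T f
Σ₄-+ S T f = expand (S 0) (S 1) (S 2) (S 3) (T 0) (T 1) (T 2) (T 3) (f 0) (f 1) (f 2) (f 3)
  where
  expand : ∀ s0 s1 s2 s3 t0 t1 t2 t3 f0 f1 f2 f3 →
    (s0 ℤ.+ t0) ℤ.* f0 ℤ.+ (s1 ℤ.+ t1) ℤ.* f1 ℤ.+ (s2 ℤ.+ t2) ℤ.* f2 ℤ.+ (s3 ℤ.+ t3) ℤ.* f3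
    ≡ (s0 ℤ.* f0 ℤ.+ s1 ℤ.* f1 ℤ.+ s2 ℤ.* f2 ℤ.+ s3 ℤ.* f3)
      ℤ.+ (t0 ℤ.* f0 ℤ.+ t1 ℤ.* f1 ℤ.+ t2 ℤ.* f2 ℤ.+ t3 ℤ.* f3)
  expand = solve-∀

Σ₄-cong : ∀ {S T} f → (∀ r → S r ≡ T r) → Σ₄ S f ≡ Σ₄ T f
Σ₄-cong f S≡T rewrite S≡T 0 | S≡T 1 | S≡T 2 | S≡T 3 = refl

-- pick m r z is z if m = r and 0 otherwise: the contribution of a term z
-- with residue m to the sum over residue class r.
pick : ℕ → ℕ → ℤ → ℤ
pick m r z with m ℕ.≟ r
... | yes _ = z
... | no  _ = 0ℤ

Σ₄-pick : ∀ m → m < 4 → ∀ z f → Σ₄ (λ r → pick m r z) f ≡ z ℤ.* f m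
Σ₄-pick 0 _ z f = trans (ℤP.+-identityʳ _) (trans (ℤP.+-identityʳ _) (ℤP.+-identityʳ _))
Σ₄-pick 1 _ z f = trans (ℤP.+-identityʳ _) (trans (ℤP.+-identityʳ _) (ℤP.+-identityˡ _))
Σ₄-pick 2 _ z f = trans (ℤP.+-identityʳ _) (ℤP.+-identityˡ _)
Σ₄-pick 3 _ z f = ℤP.+-identityˡ _
Σ₄-pick (suc (suc (suc (suc _)))) (s≤s (s≤s (s≤s (s≤s ()))))

s4-step : ∀ a j r → s4 (suc j) a r ≡ s4 j a r ℤ.+ pick (suc j % 4) r (a (suc j))
s4-step a j r with suc j % 4 ℕ.≟ r
... | yes _ = refl
... | no  _ = refl

Σ₁ℤ-cong : ∀ j {f g : ℕ → ℤ} → (∀ i → i ≤ j → f i ≡ g i) → Σ₁ℤ j f ≡ Σ₁ℤ j g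
Σ₁ℤ-cong zero    _   = refl
Σ₁ℤ-cong (suc j) f≡g =
  cong₂ ℤ._+_ (Σ₁ℤ-cong j (λ i i≤j → f≡g i (ℕP.m≤n⇒m≤1+n i≤j))) (f≡g (suc j) ℕP.≤-refl)

group-by-residue : ∀ a j f → Σ₁ℤ j (λ i → a i ℤ.* f (i % 4)) ≡ Σ₄ (s4 j a) f
group-by-residue a zero    f = refl
group-by-residue a (suc j) f = begin
    Σ₁ℤ j (λ i → a i ℤ.* f (i % 4)) ℤ.+ a (suc j) ℤ.* f m
      ≡⟨ cong₂ ℤ._+_ (group-by-residue a j f) (sym (Σ₄-pick m (ℕD.m%n<n (suc j) 4) (a (suc j)) f)) ⟩
    Σ₄ (s4 j a) f ℤ.+ Σ₄ (λ r → pick m r (a (suc j))) f      ≡⟨ sym (Σ₄-+ (s4 j a) (λ r → pick m r (a (suc j))) f) ⟩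
    Σ₄ (λ r → s4 j a r ℤ.+ pick m r (a (suc j))) f           ≡⟨ Σ₄-cong f (λ r → sym (s4-step a j r)) ⟩
    Σ₄ (s4 (suc j) a) f                                       ∎
  where
  open ≡-Reasoning
  m : ℕ
  m = suc j % 4

numerator : ℤ → ℤ → ℕ → ℤ
numerator A B 1 = ((A ℤ.* A ℤ.- A) ℤ.+ B ℤ.* B) ℤ.- B
numerator A B 2 = ((A ℤ.* A ℤ.- A) ℤ.+ B ℤ.* B) ℤ.+ B
numerator A B 3 = ((A ℤ.* A ℤ.+ A) ℤ.+ B ℤ.* B) ℤ.+ B
numerator A B _ = ((A ℤ.* A ℤ.+ A) ℤ.+ B ℤ.* B) ℤ.- B

-- If s₀ + s₁ + s₂ + s₃ = 2t, A = s₁ − s₃ and B = s₂ − s₀ + 1, then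
-- Σₖ sₖ N (r − k) = N r + Q t′, where t′ = t for r ∈ {0,1} and t′ = t − 1
-- for r ∈ {2,3}.  (The evenness hypothesis is stated solved for s₀.)
rotated-numerators : ∀ s0 s1 s2 s3 t A B →
  s0 ≡ t ℤ.* + 2 ℤ.- (s1 ℤ.+ s2 ℤ.+ s3) → A ≡ s1 ℤ.- s3 → B ≡ (s2 ℤ.- s0) ℤ.+ 1ℤ →
  let N₁ = ((A ℤ.* A ℤ.- A) ℤ.+ B ℤ.* B) ℤ.- B
      N₂ = ((A ℤ.* A ℤ.- A) ℤ.+ B ℤ.* B) ℤ.+ B
      N₃ = ((A ℤ.* A ℤ.+ A) ℤ.+ B ℤ.* B) ℤ.+ B
      N₀ = ((A ℤ.* A ℤ.+ A) ℤ.+ B ℤ.* B) ℤ.- B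
      Q  = + 2 ℤ.* (A ℤ.* A) ℤ.+ + 2 ℤ.* (B ℤ.* B)
  in  (s0 ℤ.* N₀ ℤ.+ s1 ℤ.* N₃ ℤ.+ s2 ℤ.* N₂ ℤ.+ s3 ℤ.* N₁ ≡ N₀ ℤ.+ Q ℤ.* t)
    × (s0 ℤ.* N₁ ℤ.+ s1 ℤ.* N₀ ℤ.+ s2 ℤ.* N₃ ℤ.+ s3 ℤ.* N₂ ≡ N₁ ℤ.+ Q ℤ.* t)
    × (s0 ℤ.* N₂ ℤ.+ s1 ℤ.* N₁ ℤ.+ s2 ℤ.* N₀ ℤ.+ s3 ℤ.* N₃ ≡ N₂ ℤ.+ Q ℤ.* (t ℤ.- 1ℤ))
    × (s0 ℤ.* N₃ ℤ.+ s1 ℤ.* N₂ ℤ.+ s2 ℤ.* N₁ ℤ.+ s3 ℤ.* N₀ ≡ N₃ ℤ.+ Q ℤ.* (t ℤ.- 1ℤ))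
rotated-numerators _ s1 s2 s3 t _ _ refl refl refl =
  solveℤ vars , solveℤ vars , solveℤ vars , solveℤ vars
  where
  vars : List ℤ
  vars = s1 ∷ s2 ∷ s3 ∷ t ∷ []

first-summand : ∀ S {T} → Σ₄ S (λ _ → 1ℤ) ≡ T → S 0 ≡ T ℤ.- (S 1 ℤ.+ S 2 ℤ.+ S 3)
first-summand S sum≡T =
  trans (isolate (S 0) (S 1) (S 2) (S 3)) (cong (ℤ._- (S 1 ℤ.+ S 2 ℤ.+ S 3)) sum≡T)
  where
  isolate : ∀ s0 s1 s2 s3 →
    s0 ≡ (s0 ℤ.* 1ℤ ℤ.+ s1 ℤ.* 1ℤ ℤ.+ s2 ℤ.* 1ℤ ℤ.+ s3 ℤ.* 1ℤ) ℤ.- (s1 ℤ.+ s2 ℤ.+ s3)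
  isolate = solve-∀

rotation : ∀ S t → Σ₄ S (λ _ → 1ℤ) ≡ t ℤ.* + 2 → ∀ r → r < 4 →
  let A = S 1 ℤ.- S 3
      B = (S 2 ℤ.- S 0) ℤ.+ 1ℤ
  in  Σ ℤ λ t′ → Σ₄ S (λ k → numerator A B ((r + 3 ℕ.* k) % 4))
                 ≡ numerator A B r ℤ.+ (+ 2 ℤ.* (A ℤ.* A) ℤ.+ + 2 ℤ.* (B ℤ.* B)) ℤ.* t′
rotation S t even 0 _ =
  t , proj₁ (rotated-numerators (S 0) (S 1) (S 2) (S 3) t _ _ (first-summand S even) refl refl)
rotation S t even 1 _ =
  t , proj₁ (proj₂ (rotated-numerators (S 0) (S 1) (S 2) (S 3) t _ _ (first-summand S even) refl refl))
rotation S t even 2 _ =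
  t ℤ.- 1ℤ , proj₁ (proj₂ (proj₂ (rotated-numerators (S 0) (S 1) (S 2) (S 3) t _ _ (first-summand S even) refl refl)))
rotation S t even 3 _ =
  t ℤ.- 1ℤ , proj₂ (proj₂ (proj₂ (rotated-numerators (S 0) (S 1) (S 2) (S 3) t _ _ (first-summand S even) refl refl)))
rotation S t even (suc (suc (suc (suc _)))) (s≤s (s≤s (s≤s (s≤s ()))))

module Recurrence (d : ℕ) (a : ℕ → ℤ) where

  A B Q : ℤ
  A = Aof d a
  B = Bof d a
  Q = Qof d a

  y : ℕ → ℚ
  y n = numerator A B (n % 4) ÷ℤ Q

  y-periodic : ∀ n → y (n + 4) ≡ y n
  y-periodic n = cong (λ r → numerator A B r ÷ℤ Q) (ℕD.[m+n]%n≡m%n n 4)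

  initVal≡y : ∀ i → initVal d a i ≡ y i
  initVal≡y i with i % 4
  ... | 0 = refl
  ... | 1 = refl
  ... | 2 = refl
  ... | 3 = refl
  ... | suc (suc (suc (suc _))) = refl

  residue-sums-total : Σ₁ℤ d a ≡ Σ₄ (s4 d a) (λ _ → 1ℤ)
  residue-sums-total =
    trans (Σ₁ℤ-cong d (λ i _ → sym (ℤP.*-identityʳ (a i)))) (group-by-residue a d (λ _ → 1ℤ))

  recurrence-numerator : ∀ t → Σ₁ℤ d a ≡ t ℤ.* + 2 → ∀ n → d ≤ n → Σ ℤ λ t′ →
    Σ₁ℤ d (λ i → a i ℤ.* numerator A B ((n ∸ i) % 4)) ≡ numerator A B (n % 4) ℤ.+ Q ℤ.* t′
  recurrence-numerator t even n d≤n
    with rotation (s4 d a) t (trans (sym residue-sums-total) even) (n % 4) (ℕD.m%n<n n 4)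
  ... | t′ , rotated = t′ , (begin
      Σ₁ℤ d (λ i → a i ℤ.* numerator A B ((n ∸ i) % 4))
        ≡⟨ Σ₁ℤ-cong d (λ i i≤d → cong (λ r → a i ℤ.* numerator A B r) (residue-∸ (ℕP.≤-trans i≤d d≤n))) ⟩
      Σ₁ℤ d (λ i → a i ℤ.* numerator A B ((n % 4 + 3 ℕ.* (i % 4)) % 4))
        ≡⟨ group-by-residue a d (λ k → numerator A B ((n % 4 + 3 ℕ.* k) % 4)) ⟩
      Σ₄ (s4 d a) (λ k → numerator A B ((n % 4 + 3 ℕ.* k) % 4))
        ≡⟨ rotated ⟩
      numerator A B (n % 4) ℤ.+ Q ℤ.* t′ ∎)
    where open ≡-Reasoning

  module _ (t : ℤ) (even : Σ₁ℤ d a ≡ t ℤ.* + 2) (x : ℕ → ℚ)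
           (recurrence : ∀ n → d < n → x n ≡ Σ₁ d (λ i → ι (a i) * x (n ∸ i)))
           (initial : ∀ i → 1 ≤ i → i ≤ d → x i ≡ initVal d a i) where

    beyond-initial : ∀ n → d < n → (∀ {m} → m < n → 1 ≤ m → x m ≡₁ y m) → x n ≡₁ y n
    beyond-initial n d<n IH with ÷ℤ-as-scaling Q | recurrence-numerator t even n (ℕP.<⇒≤ d<n)
    ... | c , ÷≡*c , add-multiple | t′ , numerator≡ = begin
        x n                                                       ≡⟨ recurrence n d<n ⟩
        Σ₁ d (λ i → ι (a i) * x (n ∸ i))                          ∼⟨ ≡₁-Σ₁ d termwise ⟩
        Σ₁ d (λ i → ι (a i ℤ.* N (n ∸ i)) * c)                    ≡⟨ Σ₁-ι-scale d (λ i → a i ℤ.* N (n ∸ i)) c ⟩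
        ι (Σ₁ℤ d (λ i → a i ℤ.* N (n ∸ i))) * c                   ≡⟨ cong (λ m → ι m * c) numerator≡ ⟩
        ι (N n ℤ.+ Q ℤ.* t′) * c                                  ∼⟨ add-multiple (N n) t′ ⟩
        ι (N n) * c                                               ≡⟨ sym (÷≡*c (N n)) ⟩
        y n                                                       ∎
      where
      open ≡₁-Reasoning
      N : ℕ → ℤ
      N m = numerator A B (m % 4)
      termwise : ∀ i → 1 ≤ i → i ≤ d → ι (a i) * x (n ∸ i) ≡₁ ι (a i ℤ.* N (n ∸ i)) * c
      termwise i 1≤i i≤d = begin
          ι (a i) * x (n ∸ i)           ∼⟨ ≡₁-scale (a i) (IH n∸i<n 1≤n∸i) ⟩
          ι (a i) * y (n ∸ i)           ≡⟨ cong (ι (a i) *_) (÷≡*c (N (n ∸ i))) ⟩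
          ι (a i) * (ι (N (n ∸ i)) * c) ≡⟨ sym (ℚP.*-assoc (ι (a i)) (ι (N (n ∸ i))) c) ⟩
          ι (a i) * ι (N (n ∸ i)) * c   ≡⟨ cong (_* c) (sym (ι-* (a i) (N (n ∸ i)))) ⟩
          ι (a i ℤ.* N (n ∸ i)) * c     ∎
        where
        i<n : i < n
        i<n = ℕP.≤-<-trans i≤d d<n
        n∸i<n : n ∸ i < n
        n∸i<n = ℕP.∸-monoʳ-< {n} {i} {0} 1≤i (ℕP.<⇒≤ i<n)
        1≤n∸i : 1 ≤ n ∸ i
        1≤n∸i = ℕP.m<n⇒0<n∸m i<n

    x≡₁y : ∀ n → 1 ≤ n → x n ≡₁ y n
    x≡₁y = <-rec (λ n → 1 ≤ n → x n ≡₁ y n) step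
      where
      step : ∀ n → (∀ {m} → m < n → 1 ≤ m → x m ≡₁ y m) → 1 ≤ n → x n ≡₁ y n
      step n IH 1≤n with n ℕP.≤? d
      ... | yes n≤d = ≡-to-≡₁ (trans (initial n 1≤n n≤d) (initVal≡y n))
      ... | no  n≰d = beyond-initial n (ℕP.≰⇒> n≰d) IH

lemma3p4 : (d : ℕ) (a : ℕ → ℤ) → (+ 2) ∣ Σ₁ℤ d a →
    (x : ℕ → ℚ) →
    (∀ n → d < n → x n ≡ Σ₁ d (λ i → ι (a i) * x (n ∸ i))) →
    (∀ i → 1 ≤ i → i ≤ d → x i ≡ initVal d a i) →
    ∀ n → 1 ≤ n → frac (x (n + 4)) ≡ frac (x n)
lemma3p4 d a 2∣sum x recurrence initial n 1≤n = begin
    frac (x (n + 4))  ≡⟨ ≡₁-frac (x≡₁y′ (n + 4) (ℕP.≤-trans 1≤n (ℕP.m≤m+n n 4))) ⟩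
    frac (y (n + 4))  ≡⟨ cong frac (y-periodic n) ⟩
    frac (y n)        ≡⟨ sym (≡₁-frac (x≡₁y′ n 1≤n)) ⟩
    frac (x n)        ∎
  where
  open ≡-Reasoning
  open Recurrence d a
  open ℤS._∣_ (ℤS.∣ᵤ⇒∣ {+ 2} {Σ₁ℤ d a} 2∣sum) using (quotient; equality)
  x≡₁y′ : ∀ m → 1 ≤ m → x m ≡₁ y m
  x≡₁y′ = x≡₁y quotient equality x recurrence initial
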